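{- Let $Y$ be a graph that is a generalized truncation of some multigraph. If $Y$ has a unique isolating perfect matching $M$, and for any two distinct components of $Y\setminus M$ there is at least one edge of $M$ joining them, then $|\mathrm{src}(Y)|=1$.
   Context: A multigraph may have multiple edges but no loops; a graph has neither loops nor multiple edges. Multigraphs from which generalized truncations are formed are assumed to have no isolated vertices. Generalized truncation: let $X$ be a multigraph. Take a matching $M_0$ with $|M_0|=|E(X)|$ (on $2|E(X)|$ new vertices) and a bijection $F:E(X)\to M_0$; for each edge $e$ of $X$ with ends $u,v$, label one end of $F(e)$ by $u$ and the other by $v$. For $v\in V(X)$, the cluster $\mathrm{cl}(v)$ is the set of vertices labelled $v$; insert an arbitrary graph $\mathrm{con}(v)$ on $\mathrm{cl}(v)$. The graph $F(M_0)\cup\bigcup_v\mathrm{con}(v)$, and any graph isomorphic to it, is a generalized truncation of $X$. For a graph $Y$, the source $\mathrm{src}(Y)$ is the set of multigraphs $X$ (without loops, considered up to isomorphism) such that $Y$ is a generalized truncation of $X$. $Y\setminus M$ denotes $Y$ with the edges of $M$ deleted. A perfect matching $M$ of $Y$ is isolating if no edge of $M$ has both end vertices in the same component of $Y\setminus M$. -}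

module Defs where

open import Data.Nat using (ℕ)
open import Data.Fin using (Fin; zero; suc)
open import Data.Bool using (Bool; true; false; _∧_; not)
open import Data.Product using (Σ; ∃; ∃-syntax; _×_; _,_; proj₁)
open import Data.Sum using (_⊎_)
open import Relation.Binary.PropositionalEquality using (_≡_; _≢_)
open import Relation.Nullary using (¬_)
open import Function.Bundles using (_⤖_; Bijection)

record Graph : Set where
  field
    n      : ℕ
    adj    : Fin n → Fin n → Bool
    sym    : ∀ x y → adj x y ≡ adj y x
    irrefl : ∀ x → adj x x ≡ false
open Graph public

record Multigraph : Set where
  field
    nV        : ℕ
    nE        : ℕ
    ends      : Fin nE → Fin 2 → Fin nV
    loopless  : ∀ e → ends e zero ≢ ends e (suc zero)
    noIsolated : ∀ v → ∃[ e ] ∃[ i ] (ends e i ≡ v)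
open Multigraph public

MultiIso : Multigraph → Multigraph → Set
MultiIso X X' =
  Σ (Fin (nV X) ⤖ Fin (nV X')) λ α →
  Σ (Fin (nE X) ⤖ Fin (nE X')) λ β →
  ∀ e →
    let a = Bijection.to α ; b = Bijection.to β in
    (a (ends X e zero) ≡ ends X' (b e) zero × a (ends X e (suc zero)) ≡ ends X' (b e) (suc zero))
    ⊎ (a (ends X e zero) ≡ ends X' (b e) (suc zero) × a (ends X e (suc zero)) ≡ ends X' (b e) zero)

-- Y is a generalized truncation of X: the vertices of Y correspond bijectively
-- (via ψ) to the ends (e , i) of the edges of X (the vertices of the matching
-- M₀ = F(E(X)); the end (e , i) is labelled  ends X e i ); for every edge e the
-- two ends form an edge of Y (the edge F(e)), and every edge of Y is either
-- such an edge F(e) or joins two vertices with the same label (lies in some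
-- con(v), an arbitrary graph on the cluster cl(v)).
IsGenTrunc : Graph → Multigraph → Set
IsGenTrunc Y X =
  Σ ((Fin (nE X) × Fin 2) ⤖ Fin (n Y)) λ ψ →
    let p = Bijection.to ψ
        lab : Fin (nE X) × Fin 2 → Fin (nV X)
        lab d = ends X (proj₁ d) (Data.Product.proj₂ d)
    in (∀ e → adj Y (p (e , zero)) (p (e , suc zero)) ≡ true)
     × (∀ d d' → adj Y (p d) (p d') ≡ true → (proj₁ d ≡ proj₁ d') ⊎ (lab d ≡ lab d'))

record PerfectMatching (Y : Graph) : Set where
  field
    M       : Fin (n Y) → Fin (n Y) → Bool
    M-sym   : ∀ x y → M x y ≡ M y x
    M⊆E     : ∀ x y → M x y ≡ true → adj Y x y ≡ true
    M-exactlyOne : ∀ x → ∃[ y ] (M x y ≡ true × (∀ z → M x z ≡ true → z ≡ y))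
open PerfectMatching public

adjMinus : (Y : Graph) → PerfectMatching Y → Fin (n Y) → Fin (n Y) → Bool
adjMinus Y P x y = adj Y x y ∧ not (M P x y)

data Reach {k : ℕ} (a : Fin k → Fin k → Bool) (x : Fin k) : Fin k → Set where
  here : Reach a x x
  step : ∀ {y z} → Reach a x y → a y z ≡ true → Reach a x z

SameComp : (Y : Graph) → PerfectMatching Y → Fin (n Y) → Fin (n Y) → Set
SameComp Y P = Reach (adjMinus Y P)

Isolating : (Y : Graph) → PerfectMatching Y → Set
Isolating Y P = ∀ x y → M P x y ≡ true → ¬ SameComp Y P x y

UniqueIsolating : (Y : Graph) → PerfectMatching Y → Set
UniqueIsolating Y P =
  Isolating Y P × (∀ (Q : PerfectMatching Y) → Isolating Y Q → ∀ x y → M Q x y ≡ M P x y)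

ComponentsJoined : (Y : Graph) → PerfectMatching Y → Set
ComponentsJoined Y P =
  ∀ x y → ¬ SameComp Y P x y →
    ∃[ x' ] ∃[ y' ] (SameComp Y P x x' × SameComp Y P y y' × M P x' y' ≡ true)

SrcSingleton : Graph → Set
SrcSingleton Y =
  (∃[ X ] IsGenTrunc Y X)
  × (∀ X X' → IsGenTrunc Y X → IsGenTrunc Y X' → MultiIso X X')

-- Every generalized truncation structure (X, ψ) on Y yields a perfect matching M₀ = F(E(X))
-- of Y, and edges of Y outside M₀ join vertices with the same label, so components of
-- Y ∖ M₀ lie inside clusters while the two ends of an M₀-edge have different labels (X is
-- loopless). Hence M₀ is isolating, and by uniqueness M₀ = M whatever the structure. If two
-- vertices with the same label lay in different components of Y ∖ M, the M-edge joining
-- those components would join two equally labelled vertices; so the clusters are exactly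
-- the components of Y ∖ M and the edges of X are exactly the edges of M. Both partitions of
-- V(Y) are thus independent of the structure, which gives the isomorphism between any two
-- members of src(Y).
module Submission where

open import Defs renaming (sym to adj-sym)
open import Data.Bool using (Bool; true; false)
open import Data.Empty using (⊥-elim)
open import Data.Fin using (Fin; zero; suc)
open import Data.Fin.Properties using (_≟_; 0≢1+n)
open import Data.Product using (Σ; ∃-syntax; _×_; _,_; proj₁; proj₂)
open import Data.Sum using (_⊎_; inj₁; inj₂; map₂)
open import Function using (_∘_)
open import Function.Bundles using (_⤖_; _⇔_; Bijection; Equivalence; Inverse; mk⤖; mk⇔)
open import Function.Consequences.Propositional using (strictlySurjective⇒surjective)
open import Function.Definitions using (StrictlySurjective)
open import Function.Properties.Bijection using (⤖⇒↔)
open import Relation.Binary.PropositionalEquality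
open import Relation.Nullary using (¬_; Dec; yes; does)
open import Relation.Nullary.Decidable using (dec-true; does-⇔; decidable-stable)
open import Relation.Nullary.Negation using (¬¬-map; contradiction)

does-true⇒ : {A : Set} (a? : Dec A) → does a? ≡ true → A
does-true⇒ (yes a) _ = a

sameKernel⇒⤖ : {A B C : Set} (f : A → B) (g : A → C) →
  StrictlySurjective _≡_ f → StrictlySurjective _≡_ g →
  (∀ {a a'} → f a ≡ f a' → g a ≡ g a') → (∀ {a a'} → g a ≡ g a' → f a ≡ f a') →
  Σ (B ⤖ C) λ h → ∀ a → Bijection.to h (f a) ≡ g a
sameKernel⇒⤖ {B = B} {C} f g f-surj g-surj f⇒g g⇒f =
  mk⤖ {to = h} (h-injective , strictlySurjective⇒surjective h-surjective) , h∘f≗g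
  where
  section : B → _
  section b = proj₁ (f-surj b)

  h : B → C
  h = g ∘ section

  h∘f≗g : ∀ a → h (f a) ≡ g a
  h∘f≗g a = f⇒g (proj₂ (f-surj (f a)))

  h-injective : ∀ {b b'} → h b ≡ h b' → b ≡ b'
  h-injective {b} {b'} eq = trans (sym (proj₂ (f-surj b))) (trans (g⇒f eq) (proj₂ (f-surj b')))

  h-surjective : StrictlySurjective _≡_ h
  h-surjective c = let a , ga≡c = g-surj c in f a , trans (h∘f≗g a) ga≡c

Reach-invariant : ∀ {k} {a : Fin k → Fin k → Bool} {B : Set} (f : Fin k → B) →
  (∀ {y z} → a y z ≡ true → f y ≡ f z) → ∀ {x y} → Reach a x y → f x ≡ f y
Reach-invariant f f-step here = refl
Reach-invariant f f-step (step r a) = trans (Reach-invariant f f-step r) (f-step a)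

adjMinus-true : (Y : Graph) (P : PerfectMatching Y) (x y : Fin (n Y)) →
  adjMinus Y P x y ≡ true → adj Y x y ≡ true × M P x y ≡ false
adjMinus-true Y P x y h with adj Y x y | M P x y
adjMinus-true Y P x y h  | true  | false = refl , refl
adjMinus-true Y P x y () | true  | true
adjMinus-true Y P x y () | false | _

other : Fin 2 → Fin 2
other zero       = suc zero
other (suc zero) = zero

other-involutive : ∀ i → other (other i) ≡ i
other-involutive zero       = refl
other-involutive (suc zero) = refl

≡-or-other : ∀ i j → j ≡ i ⊎ j ≡ other i
≡-or-other zero       zero       = inj₁ refl
≡-or-other zero       (suc zero) = inj₂ refl
≡-or-other (suc zero) zero       = inj₂ refl
≡-or-other (suc zero) (suc zero) = inj₁ refl

unorderedPair : {A : Set} (u : Fin 2 → A) {a b : A} {i j : Fin 2} → i ≢ j → a ≡ u i → b ≡ u j →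
  (a ≡ u zero × b ≡ u (suc zero)) ⊎ (a ≡ u (suc zero) × b ≡ u zero)
unorderedPair u {i = zero}     {zero}     i≢j _ _ = ⊥-elim (i≢j refl)
unorderedPair u {i = zero}     {suc zero} _ a≡ b≡ = inj₁ (a≡ , b≡)
unorderedPair u {i = suc zero} {zero}     _ a≡ b≡ = inj₂ (a≡ , b≡)
unorderedPair u {i = suc zero} {suc zero} i≢j _ _ = ⊥-elim (i≢j refl)

ends-other-≢ : (X : Multigraph) → ∀ e i → ends X e (other i) ≢ ends X e i
ends-other-≢ X e zero       = loopless X e ∘ sym
ends-other-≢ X e (suc zero) = loopless X e

module Truncation (Y : Graph) (X : Multigraph) (G : IsGenTrunc Y X) where
  open Inverse (⤖⇒↔ (proj₁ G)) public using (to; from; strictlyInverseˡ; strictlyInverseʳ)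

  edgeOf : Fin (n Y) → Fin (nE X)
  edgeOf = proj₁ ∘ from

  endOf : Fin (n Y) → Fin 2
  endOf = proj₂ ∘ from

  label : Fin (n Y) → Fin (nV X)
  label y = ends X (edgeOf y) (endOf y)

  partner : Fin (n Y) → Fin (n Y)
  partner y = to (edgeOf y , other (endOf y))

  vertex-parts : ∀ {y e i} → edgeOf y ≡ e → endOf y ≡ i → to (e , i) ≡ y
  vertex-parts refl refl = strictlyInverseˡ _

  edgeOf-to : ∀ e i → edgeOf (to (e , i)) ≡ e
  edgeOf-to e i = cong proj₁ (strictlyInverseʳ (e , i))

  endOf-to : ∀ e i → endOf (to (e , i)) ≡ i
  endOf-to e i = cong proj₂ (strictlyInverseʳ (e , i))

  label-to : ∀ e i → label (to (e , i)) ≡ ends X e i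
  label-to e i = cong (λ d → ends X (proj₁ d) (proj₂ d)) (strictlyInverseʳ (e , i))

  edgeOf-partner : ∀ y → edgeOf (partner y) ≡ edgeOf y
  edgeOf-partner y = edgeOf-to _ _

  partner-involutive : ∀ y → partner (partner y) ≡ y
  partner-involutive y = trans
    (cong₂ (λ e i → to (e , i)) (edgeOf-partner y)
           (trans (cong other (endOf-to _ _)) (other-involutive (endOf y))))
    (strictlyInverseˡ y)

  label-partner-≢ : ∀ y → label (partner y) ≢ label y
  label-partner-≢ y eq = ends-other-≢ X (edgeOf y) (endOf y)
    (trans (sym (label-to _ _)) eq)

  adj-partner : ∀ y → adj Y y (partner y) ≡ true
  adj-partner y = subst (λ x → adj Y x (partner y) ≡ true) (strictlyInverseˡ y)
    (adj-to-other (edgeOf y) (endOf y))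
    where
    adj-to-other : ∀ e i → adj Y (to (e , i)) (to (e , other i)) ≡ true
    adj-to-other e zero       = proj₁ (proj₂ G) e
    adj-to-other e (suc zero) = trans (adj-sym Y _ _) (proj₁ (proj₂ G) e)

  parts-injective : ∀ {y z} → edgeOf y ≡ edgeOf z → endOf y ≡ endOf z → y ≡ z
  parts-injective {y} p q = trans (sym (strictlyInverseˡ y)) (vertex-parts (sym p) (sym q))

  sameEdge⇒≡-or-partner : ∀ {y z} → edgeOf y ≡ edgeOf z → z ≡ y ⊎ z ≡ partner y
  sameEdge⇒≡-or-partner {y} {z} eq with ≡-or-other (endOf y) (endOf z)
  ... | inj₁ same     = inj₁ (sym (parts-injective eq (sym same)))
  ... | inj₂ opposite = inj₂ (sym (vertex-parts (sym eq) opposite))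

  sameEdge⇔≡-or-partner : ∀ {y z} → edgeOf y ≡ edgeOf z ⇔ (z ≡ y ⊎ z ≡ partner y)
  sameEdge⇔≡-or-partner {y} = mk⇔ sameEdge⇒≡-or-partner
    λ { (inj₁ refl) → refl ; (inj₂ refl) → sym (edgeOf-partner y) }

  nonPartner-sameLabel : ∀ {y z} → adj Y y z ≡ true → z ≢ partner y → label y ≡ label z
  nonPartner-sameLabel {y} {z} yz z≢partner with proj₂ (proj₂ G) (from y) (from z)
    (subst₂ (λ u v → adj Y u v ≡ true) (sym (strictlyInverseˡ y)) (sym (strictlyInverseˡ z)) yz)
  ... | inj₂ sameLabel = sameLabel
  ... | inj₁ sameEdge with sameEdge⇒≡-or-partner sameEdge
  ...   | inj₁ refl       = contradiction (trans (sym yz) (irrefl Y y)) λ ()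
  ...   | inj₂ z≡partner = ⊥-elim (z≢partner z≡partner)

  label-surjective : StrictlySurjective _≡_ label
  label-surjective v =
    let e , i , eq = noIsolated X v in to (e , i) , trans (label-to e i) eq

  edgeOf-surjective : StrictlySurjective _≡_ edgeOf
  edgeOf-surjective e = to (e , zero) , edgeOf-to e zero

  PartnerMatching : PerfectMatching Y → Set
  PartnerMatching Q = ∀ y z → M Q y z ≡ true ⇔ z ≡ partner y

  partner-swap : ∀ {y z} → z ≡ partner y → y ≡ partner z
  partner-swap {y} refl = sym (partner-involutive y)

  M₀ : PerfectMatching Y
  M₀ = record
    { M            = λ y z → does (z ≟ partner y)
    ; M-sym        = λ y z → does-⇔ (mk⇔ partner-swap partner-swap) (z ≟ partner y) (y ≟ partner z)
    ; M⊆E          = λ y z h → subst (λ w → adj Y y w ≡ true)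
                                     (sym (does-true⇒ (z ≟ partner y) h)) (adj-partner y)
    ; M-exactlyOne = λ y → partner y , dec-true (partner y ≟ partner y) refl
                                     , λ z → does-true⇒ (z ≟ partner y)
    }

  M₀-partnerMatching : PartnerMatching M₀
  M₀-partnerMatching y z = mk⇔ (does-true⇒ (z ≟ partner y)) (dec-true (z ≟ partner y))

  module _ (Q : PerfectMatching Y) (Q-partner : PartnerMatching Q) where

    sameComp⇒sameLabel : ∀ {y z} → SameComp Y Q y z → label y ≡ label z
    sameComp⇒sameLabel = Reach-invariant label λ {y} {z} h →
      let yz , unmatched = adjMinus-true Y Q y z h in
      nonPartner-sameLabel yz λ z≡partner →
        contradiction (trans (sym (Equivalence.from (Q-partner y z) z≡partner)) unmatched) λ ()

    partnerMatching-isolating : Isolating Y Q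
    partnerMatching-isolating y z matched yz = label-partner-≢ y (begin
      label (partner y) ≡⟨ cong label (sym (Equivalence.to (Q-partner y z) matched)) ⟩
      label z           ≡⟨ sym (sameComp⇒sameLabel yz) ⟩
      label y           ∎)
      where open ≡-Reasoning

    sameLabel⇒¬¬sameComp : ComponentsJoined Y Q → ∀ {y z} → label y ≡ label z → ¬ ¬ SameComp Y Q y z
    sameLabel⇒¬¬sameComp joined {y} {z} eq ¬yz =
      let x' , z' , yx' , zz' , matched = joined y z ¬yz in
      label-partner-≢ x' (begin
        label (partner x') ≡⟨ cong label (sym (Equivalence.to (Q-partner x' z') matched)) ⟩
        label z'           ≡⟨ sym (sameComp⇒sameLabel zz') ⟩
        label z            ≡⟨ sym eq ⟩
        label y            ≡⟨ sameComp⇒sameLabel yx' ⟩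
        label x'           ∎)
      where open ≡-Reasoning

  uniqueIsolating⇒partnerMatching : ∀ P → UniqueIsolating Y P → PartnerMatching P
  uniqueIsolating⇒partnerMatching P (_ , unique) y z =
    subst (λ b → b ≡ true ⇔ z ≡ partner y)
          (unique M₀ (partnerMatching-isolating M₀ M₀-partnerMatching) y z)
          (M₀-partnerMatching y z)

module Transfer (Y : Graph) (P : PerfectMatching Y) (unique : UniqueIsolating Y P)
                (joined : ComponentsJoined Y P)
                (X X' : Multigraph) (G : IsGenTrunc Y X) (G' : IsGenTrunc Y X') where
  private
    module T  = Truncation Y X G
    module T' = Truncation Y X' G'

    P-partner  : T.PartnerMatching P
    P-partner  = T.uniqueIsolating⇒partnerMatching P unique

    P-partner' : T'.PartnerMatching P
    P-partner' = T'.uniqueIsolating⇒partnerMatching P unique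

  partner-independent : ∀ y → T'.partner y ≡ T.partner y
  partner-independent y =
    Equivalence.to (P-partner y (T'.partner y)) (Equivalence.from (P-partner' y (T'.partner y)) refl)

  -- Labels are decidable, which removes the double negation.
  label-transfer : ∀ {y z} → T.label y ≡ T.label z → T'.label y ≡ T'.label z
  label-transfer {y} {z} eq = decidable-stable (T'.label y ≟ T'.label z)
    (¬¬-map (T'.sameComp⇒sameLabel P P-partner') (T.sameLabel⇒¬¬sameComp P P-partner joined eq))

  edgeOf-transfer : ∀ {y z} → T.edgeOf y ≡ T.edgeOf z → T'.edgeOf y ≡ T'.edgeOf z
  edgeOf-transfer {y} {z} eq = Equivalence.from (T'.sameEdge⇔≡-or-partner {y} {z})
    (map₂ (λ z≡partner → trans z≡partner (sym (partner-independent y)))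
          (Equivalence.to (T.sameEdge⇔≡-or-partner {y} {z}) eq))

src-unique : (Y : Graph) (P : PerfectMatching Y) → UniqueIsolating Y P → ComponentsJoined Y P →
  ∀ X X' → IsGenTrunc Y X → IsGenTrunc Y X' → MultiIso X X'
src-unique Y P unique joined X X' G G' = proj₁ vertexBij , proj₁ edgeBij , ends-preserved
  where
  module T   = Truncation Y X G
  module T'  = Truncation Y X' G'
  module TT' = Transfer Y P unique joined X X' G G'
  module T'T = Transfer Y P unique joined X' X G' G

  vertexBij : Σ (Fin (nV X) ⤖ Fin (nV X')) λ h → ∀ y → Bijection.to h (T.label y) ≡ T'.label y
  vertexBij = sameKernel⇒⤖ T.label T'.label T.label-surjective T'.label-surjective
                           TT'.label-transfer T'T.label-transfer

  edgeBij : Σ (Fin (nE X) ⤖ Fin (nE X')) λ h → ∀ y → Bijection.to h (T.edgeOf y) ≡ T'.edgeOf y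
  edgeBij = sameKernel⇒⤖ T.edgeOf T'.edgeOf T.edgeOf-surjective T'.edgeOf-surjective
                         TT'.edgeOf-transfer T'T.edgeOf-transfer

  a : Fin (nV X) → Fin (nV X')
  a = Bijection.to (proj₁ vertexBij)

  b : Fin (nE X) → Fin (nE X')
  b = Bijection.to (proj₁ edgeBij)

  b-edgeOf-to : ∀ e i → T'.edgeOf (T.to (e , i)) ≡ b e
  b-edgeOf-to e i = trans (sym (proj₂ edgeBij _)) (cong b (T.edgeOf-to e i))

  a-ends : ∀ e i → a (ends X e i) ≡ ends X' (b e) (T'.endOf (T.to (e , i)))
  a-ends e i = begin
    a (ends X e i)                          ≡⟨ cong a (sym (T.label-to e i)) ⟩
    a (T.label (T.to (e , i)))              ≡⟨ proj₂ vertexBij _ ⟩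
    T'.label (T.to (e , i))                 ≡⟨ cong (λ e' → ends X' e' (T'.endOf (T.to (e , i))))
                                                    (b-edgeOf-to e i) ⟩
    ends X' (b e) (T'.endOf (T.to (e , i))) ∎
    where open ≡-Reasoning

  ends-distinct : ∀ e → T'.endOf (T.to (e , zero)) ≢ T'.endOf (T.to (e , suc zero))
  ends-distinct e same = 0≢1+n (begin
    zero                          ≡⟨ sym (T.endOf-to e zero) ⟩
    T.endOf (T.to (e , zero))     ≡⟨ cong T.endOf (T'.parts-injective sameEdge same) ⟩
    T.endOf (T.to (e , suc zero)) ≡⟨ T.endOf-to e (suc zero) ⟩
    suc zero                      ∎)
    where
    open ≡-Reasoning
    sameEdge : T'.edgeOf (T.to (e , zero)) ≡ T'.edgeOf (T.to (e , suc zero))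
    sameEdge = trans (b-edgeOf-to e zero) (sym (b-edgeOf-to e (suc zero)))

  ends-preserved : ∀ e →
    (a (ends X e zero) ≡ ends X' (b e) zero × a (ends X e (suc zero)) ≡ ends X' (b e) (suc zero))
    ⊎ (a (ends X e zero) ≡ ends X' (b e) (suc zero) × a (ends X e (suc zero)) ≡ ends X' (b e) zero)
  ends-preserved e = unorderedPair (ends X' (b e)) (ends-distinct e) (a-ends e zero) (a-ends e (suc zero))

theorem2p8 : (Y : Graph) → (∃[ X ] IsGenTrunc Y X) →
    (P : PerfectMatching Y) → UniqueIsolating Y P → ComponentsJoined Y P →
    SrcSingleton Y
theorem2p8 Y inSource P unique joined = inSource , src-unique Y P unique joined
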